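{- Let $\Gamma$ be a finite, simple, connected bipartite graph of diameter $3$ with bipartition sets $X$ and $Y$. Then precisely one of the following holds: (i) $\Gamma$ is highly distance-balanced; (ii) $\Gamma$ is $2$-distance-balanced but neither $1$-distance-balanced nor $3$-distance-balanced; (iii) $\Gamma$ is $3$-distance-balanced but neither $1$-distance-balanced nor $2$-distance-balanced; (iv) $\Gamma$ is not $\ell$-distance-balanced for any $1 \le \ell \le 3$.
   Context: For vertices $u,v$, $W_{uv} = \{w \mid d(u,w) < d(v,w)\}$. For a positive integer $\ell$, a connected graph of diameter at least $\ell$ is $\ell$-distance-balanced if $|W_{uv}| = |W_{vu}|$ for all $u,v$ with $d(u,v)=\ell$. A connected graph of diameter $D$ is highly distance-balanced if it is $\ell$-distance-balanced for every $1 \le \ell \le D$. -}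

module Defs where

open import Data.Nat using (ℕ; zero; suc; _≤_; _<_; _<?_)
open import Data.Fin using (Fin; _≟_)
open import Data.Bool using (Bool; true; false; _∨_; _∧_; if_then_else_; not)
open import Data.List using (List; filter; length)
open import Data.Bool.ListAction using (any)
open import Data.List using () renaming (allFin to allFinL)
open import Data.Product using (Σ; _×_; ∃-syntax)
open import Data.Sum using (_⊎_)
open import Relation.Nullary using (¬_; does)
open import Relation.Binary.PropositionalEquality using (_≡_; _≢_)

record Graph : Set where
  field
    n     : ℕ
    adj   : Fin n → Fin n → Bool
    sym   : ∀ u v → adj u v ≡ adj v u
    irrefl : ∀ u → adj u u ≡ false

module _ (G : Graph) where
  open Graph G

  reach : ℕ → Fin n → Fin n → Bool
  reach zero u v = does (u ≟ v)
  reach (suc k) u v = reach k u v ∨ any (λ w → reach k u w ∧ adj w v) (allFinL n)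

  search : Fin n → Fin n → ℕ → ℕ → ℕ
  search u v k zero = k
  search u v k (suc fuel) = if reach k u v then k else search u v (suc k) fuel

  -- path-length distance d(u,v) = least k with a u-v walk of length ≤ k
  -- (meaningful for connected graphs, where every pair is joined within n steps)
  dist : Fin n → Fin n → ℕ
  dist u v = search u v 0 (suc n)

  Connected : Set
  Connected = ∀ u v → reach n u v ≡ true

  HasDiameter : ℕ → Set
  HasDiameter D = (∃[ u ] ∃[ v ] dist u v ≡ D) × (∀ u v → dist u v ≤ D)

  Bipartite : Set
  Bipartite = Σ (Fin n → Bool) λ c → ∀ u v → adj u v ≡ true → c u ≢ c v

  W : Fin n → Fin n → List (Fin n)
  W u v = filter (λ w → dist u w <? dist v w) (allFinL n)

  DistBalanced : ℕ → Set
  DistBalanced ℓ = (∃[ u ] ∃[ v ] ℓ ≤ dist u v)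
                 × (∀ u v → dist u v ≡ ℓ → length (W u v) ≡ length (W v u))

  HighlyDistBalanced : Set
  HighlyDistBalanced = Σ ℕ λ D → HasDiameter D × (∀ ℓ → 1 ≤ ℓ → ℓ ≤ D → DistBalanced ℓ)

ExactlyOne4 : Set → Set → Set → Set → Set
ExactlyOne4 P Q R S =
  (P ⊎ Q ⊎ R ⊎ S)
  × ¬ (P × Q) × ¬ (P × R) × ¬ (P × S) × ¬ (Q × R) × ¬ (Q × S) × ¬ (R × S)

-- Vertices at distance 1 or 3 lie in opposite colour classes, and counting the possible
-- distance pairs (d(p,w), d(q,w)) over all w gives |W_pq| + deg q = e(p) + deg p, where e(p),
-- the number of vertices at even distance from p, is the size of p's colour class. So such a
-- pair is balanced iff the weights e + 2 deg agree. Vertices at distance 2 share a colour and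
-- satisfy |W_pq| + |N(p) ∩ N(q)| = 1 + deg p, so they are balanced iff their degrees agree.
-- Hence 1-balance makes the weight constant along edges, hence everywhere, giving 2- and
-- 3-balance; conversely 2-balance makes the weight constant on each colour class, and a single
-- balanced pair at distance 3 identifies the two constants, giving 1-balance. The four cases
-- are the combinations that remain.

module Submission where

open import Defs
open import Data.Product using (_×_)
open import Relation.Nullary using (¬_)
open import Data.Bool using (Bool; true; false; not; _∧_; _xor_; T)
import Data.Bool as Bool
open import Data.Bool.Properties using (T-∨; T-∧; T-≡; ¬-not; xor-same; not-distribˡ-xor; not-distribʳ-xor; ∧-comm)
open import Data.Fin using (Fin; zero; suc; _≟_; punchIn)
open import Data.Fin.Properties using (all?; punchInᵢ≢i)
open import Data.List using (length; filter; tabulate; allFin)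
open import Data.List.Membership.Propositional using (lose)
open import Data.List.Membership.Propositional.Properties using (∈-allFin)
open import Data.List.Relation.Unary.Any using (satisfied)
open import Data.List.Relation.Unary.Any.Properties using (any⁺; any⁻)
open import Data.Nat using (ℕ; zero; suc; _+_; _*_; _≤_; _<?_; _≡ᵇ_; z≤n; s≤s)
import Data.Nat as ℕ
open import Data.Nat.Properties
  using (≡ᵇ⇒≡; ≡⇒≡ᵇ; +-identityʳ; +-suc; +-comm; +-assoc; +-cancelʳ-≡; +-cancelˡ-≡; *-cancelˡ-≡;
         ≤-refl; ≤-trans; ≤-antisym; ≤∧≢⇒<; m≤n⇒m≤1+n; n≤0⇒n≡0; +-0-commutativeMonoid)
open import Algebra.Properties.CommutativeMonoid.Sum +-0-commutativeMonoid
  using (sum; sum-cong-≗; ∑-distrib-+; sum-remove; sum-replicate-zero)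
open import Data.Product using (_,_; ∃-syntax)
open import Data.Sum using (_⊎_; inj₁; inj₂)
open import Function using (_∘_; _⇔_; mk⇔; Equivalence)
open import Relation.Nullary using (Dec; yes; no; does; contradiction)
open import Relation.Nullary.Decidable using (dec-true; map′; _→-dec_)
open import Relation.Binary.PropositionalEquality
  using (_≡_; _≢_; refl; sym; trans; cong; cong₂; subst; ≢-sym; module ≡-Reasoning)

open Equivalence using (to; from)

χ : Bool → ℕ
χ false = 0
χ true  = 1

count : ∀ {n} → (Fin n → Bool) → ℕ
count p = sum (χ ∘ p)

length-filter-tabulate : ∀ {n} {A : Set} {P : A → Set} (P? : ∀ x → Dec (P x)) (g : Fin n → A) →
                         length (filter P? (tabulate g)) ≡ count (does ∘ P? ∘ g)
length-filter-tabulate {zero}  P? g = refl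
length-filter-tabulate {suc n} P? g with does (P? (g zero))
... | true  = cong suc (length-filter-tabulate P? (g ∘ suc))
... | false = length-filter-tabulate P? (g ∘ suc)

sum-+-≗ : ∀ {n} (f g h k : Fin n → ℕ) → (∀ i → f i + g i ≡ h i + k i) → sum f + sum g ≡ sum h + sum k
sum-+-≗ f g h k e = trans (sym (∑-distrib-+ f g)) (trans (sum-cong-≗ e) (∑-distrib-+ h k))

count-unique : ∀ {n} (p : Fin n → Bool) (i : Fin n) → T (p i) → (∀ j → T (p j) → j ≡ i) → count p ≡ 1
count-unique {suc n} p i pᵢ unique = begin
  count p                           ≡⟨ sum-remove {i = i} (χ ∘ p) ⟩
  χ (p i) + sum (χ ∘ p ∘ punchIn i) ≡⟨ cong₂ _+_ (χ-T pᵢ) (trans (sum-cong-≗ elsewhere) (sum-replicate-zero n)) ⟩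
  1                                 ∎
  where
  open ≡-Reasoning
  χ-T : ∀ {b} → T b → χ b ≡ 1
  χ-T {true} _ = refl
  elsewhere : ∀ j → χ (p (punchIn i j)) ≡ 0
  elsewhere j with p (punchIn i j) in pⱼ
  ... | true  = contradiction (unique _ (subst T (sym pⱼ) _)) (punchInᵢ≢i i j)
  ... | false = refl

offset-≡⇔ : ∀ {t s c k d e} → t + c ≡ k + d → s + c ≡ k + e → (t ≡ s ⇔ d ≡ e)
offset-≡⇔ {t} {s} {c} {k} {d} {e} tc sc = mk⇔
  (λ t≡s → +-cancelˡ-≡ k d e (trans (sym tc) (trans (cong (_+ c) t≡s) sc)))
  (λ d≡e → +-cancelʳ-≡ c t s (trans tc (trans (cong (k +_) d≡e) (sym sc))))

cross-offset-≡⇔ : ∀ {t s x y d e} → t + e ≡ x + d → s + d ≡ y + e → (t ≡ s ⇔ x + 2 * d ≡ y + 2 * e)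
cross-offset-≡⇔ {t} {s} {x} {y} {d} {e} te sd = mk⇔
  (λ t≡s → begin
    x + 2 * d    ≡⟨ shift t e x d te ⟩
    t + (e + d)  ≡⟨ cong₂ _+_ t≡s (+-comm e d) ⟩
    s + (d + e)  ≡⟨ shift s d y e sd ⟨
    y + 2 * e    ∎)
  (λ w → +-cancelʳ-≡ (e + d) t s (begin
    t + (e + d)  ≡⟨ shift t e x d te ⟨
    x + 2 * d    ≡⟨ w ⟩
    y + 2 * e    ≡⟨ shift s d y e sd ⟩
    s + (d + e)  ≡⟨ cong (s +_) (+-comm d e) ⟩
    s + (e + d)  ∎))
  where
  open ≡-Reasoning
  shift : ∀ t e x d → t + e ≡ x + d → x + 2 * d ≡ t + (e + d)
  shift t e x d te = begin
    x + 2 * d    ≡⟨ cong (λ m → x + (d + m)) (+-identityʳ d) ⟩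
    x + (d + d)  ≡⟨ +-assoc x d d ⟨
    x + d + d    ≡⟨ cong (_+ d) te ⟨
    t + e + d    ≡⟨ +-assoc t e d ⟩
    t + (e + d)  ∎

odd : ℕ → Bool
odd zero    = false
odd (suc k) = not (odd k)

-- In the three tables below a = d(p,w) and b = d(q,w) for a fixed pair p, q and a varying w.
opposite-nonadjacent-pointwise : ∀ a b → a ≤ 3 → b ≤ 3 → odd b ≡ not (odd a) →
  (a ≡ 0 → b ≢ 1) → (b ≡ 0 → a ≢ 1) →
  χ (does (a <? b)) + χ (b ≡ᵇ 1) ≡ χ (not (odd a)) + χ (a ≡ᵇ 1)
opposite-nonadjacent-pointwise 0 1 _ _ _ p≁q _ = contradiction refl (p≁q refl)
opposite-nonadjacent-pointwise 0 3 _ _ _ _ _ = refl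
opposite-nonadjacent-pointwise 1 0 _ _ _ _ q≁p = contradiction refl (q≁p refl)
opposite-nonadjacent-pointwise 1 2 _ _ _ _ _ = refl
opposite-nonadjacent-pointwise 2 1 _ _ _ _ _ = refl
opposite-nonadjacent-pointwise 2 3 _ _ _ _ _ = refl
opposite-nonadjacent-pointwise 3 0 _ _ _ _ _ = refl
opposite-nonadjacent-pointwise 3 2 _ _ _ _ _ = refl
opposite-nonadjacent-pointwise 0 0 _ _ () _ _
opposite-nonadjacent-pointwise 0 2 _ _ () _ _
opposite-nonadjacent-pointwise 1 1 _ _ () _ _
opposite-nonadjacent-pointwise 1 3 _ _ () _ _
opposite-nonadjacent-pointwise 2 0 _ _ () _ _
opposite-nonadjacent-pointwise 2 2 _ _ () _ _
opposite-nonadjacent-pointwise 3 1 _ _ () _ _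
opposite-nonadjacent-pointwise 3 3 _ _ () _ _
opposite-nonadjacent-pointwise (suc (suc (suc (suc _)))) _ (s≤s (s≤s (s≤s ()))) _ _ _ _
opposite-nonadjacent-pointwise _ (suc (suc (suc (suc _)))) _ (s≤s (s≤s (s≤s ()))) _ _ _

adjacent-pointwise : ∀ a b → a ≤ 3 → b ≤ 3 → odd b ≡ not (odd a) → (a ≡ 0 → b ≡ 1) → (b ≡ 0 → a ≡ 1) →
  χ (does (a <? b)) + (χ (b ≡ᵇ 1) + χ (b ≡ᵇ 0)) ≡ χ (not (odd a)) + (χ (a ≡ᵇ 1) + χ (a ≡ᵇ 0))
adjacent-pointwise 0 1 _ _ _ _ _ = refl
adjacent-pointwise 1 0 _ _ _ _ _ = refl
adjacent-pointwise 1 2 _ _ _ _ _ = refl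
adjacent-pointwise 2 1 _ _ _ _ _ = refl
adjacent-pointwise 2 3 _ _ _ _ _ = refl
adjacent-pointwise 3 2 _ _ _ _ _ = refl
adjacent-pointwise 0 3 _ _ _ p~q _ with () ← p~q refl
adjacent-pointwise 3 0 _ _ _ _ q~p with () ← q~p refl
adjacent-pointwise 0 0 _ _ () _ _
adjacent-pointwise 0 2 _ _ () _ _
adjacent-pointwise 1 1 _ _ () _ _
adjacent-pointwise 1 3 _ _ () _ _
adjacent-pointwise 2 0 _ _ () _ _
adjacent-pointwise 2 2 _ _ () _ _
adjacent-pointwise 3 1 _ _ () _ _
adjacent-pointwise 3 3 _ _ () _ _
adjacent-pointwise (suc (suc (suc (suc _)))) _ (s≤s (s≤s (s≤s ()))) _ _ _ _
adjacent-pointwise _ (suc (suc (suc (suc _)))) _ (s≤s (s≤s (s≤s ()))) _ _ _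

same-side-pointwise : ∀ a b → a ≤ 3 → b ≤ 3 → odd b ≡ odd a → (a ≡ 0 → b ≢ 0) → (b ≡ 0 → a ≢ 0) →
  χ (does (a <? b)) + χ ((a ≡ᵇ 1) ∧ (b ≡ᵇ 1)) ≡ χ (a ≡ᵇ 0) + χ (a ≡ᵇ 1)
same-side-pointwise 0 0 _ _ _ p≢q _ = contradiction refl (p≢q refl)
same-side-pointwise 0 2 _ _ _ _ _ = refl
same-side-pointwise 1 1 _ _ _ _ _ = refl
same-side-pointwise 1 3 _ _ _ _ _ = refl
same-side-pointwise 2 0 _ _ _ _ _ = refl
same-side-pointwise 2 2 _ _ _ _ _ = refl
same-side-pointwise 3 1 _ _ _ _ _ = refl
same-side-pointwise 3 3 _ _ _ _ _ = refl
same-side-pointwise 0 1 _ _ () _ _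
same-side-pointwise 0 3 _ _ () _ _
same-side-pointwise 1 0 _ _ () _ _
same-side-pointwise 1 2 _ _ () _ _
same-side-pointwise 2 1 _ _ () _ _
same-side-pointwise 2 3 _ _ () _ _
same-side-pointwise 3 0 _ _ () _ _
same-side-pointwise 3 2 _ _ () _ _
same-side-pointwise (suc (suc (suc (suc _)))) _ (s≤s (s≤s (s≤s ()))) _ _ _ _
same-side-pointwise _ (suc (suc (suc (suc _)))) _ (s≤s (s≤s (s≤s ()))) _ _ _

module _ (G : Graph) where
  open Graph G using (n; adj; irrefl) renaming (sym to adj-sym)

  data Walk : ℕ → Fin n → Fin n → Set where
    []  : ∀ {u} → Walk 0 u u
    _▷_ : ∀ {k u w v} → Walk k u w → adj w v ≡ true → Walk (suc k) u v

  walk⇒reach : ∀ {k u v} → Walk k u v → T (reach G k u v)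
  walk⇒reach {u = u} []      = from T-≡ (dec-true (u ≟ u) refl)
  walk⇒reach {suc k} {u} {v} (p ▷ e) =
    from T-∨ (inj₂ (any⁺ (λ w → reach G k u w ∧ adj w v) (lose (∈-allFin _) (from T-∧ (walk⇒reach p , from T-≡ e)))))

  reach⇒walk : ∀ k {u v} → T (reach G k u v) → ∃[ j ] j ≤ k × Walk j u v
  reach⇒walk zero {u} {v} r with u ≟ v
  ... | yes refl = 0 , z≤n , []
  reach⇒walk (suc k) {u} {v} r with to T-∨ r
  ... | inj₁ r′ = let j , j≤k , p = reach⇒walk k r′ in j , m≤n⇒m≤1+n j≤k , p
  ... | inj₂ r′ with satisfied (any⁻ (λ w → reach G k u w ∧ adj w v) (allFin n) r′)
  ... | w , rw with to T-∧ rw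
  ... | r″ , e = let j , j≤k , p = reach⇒walk k r″ in suc j , s≤s j≤k , p ▷ to T-≡ e

  search-reaches : ∀ {u v} k fuel → T (reach G (k + fuel) u v) → T (reach G (search G u v k fuel) u v)
  search-reaches {u} {v} k zero r = subst (λ m → T (reach G m u v)) (+-identityʳ k) r
  search-reaches {u} {v} k (suc fuel) r with reach G k u v in eq
  ... | true  = from T-≡ eq
  ... | false = search-reaches (suc k) fuel (subst (λ m → T (reach G m u v)) (+-suc k fuel) r)

  search-least : ∀ {u v m} k fuel → T (reach G m u v) → k ≤ m → search G u v k fuel ≤ m
  search-least k zero r k≤m = k≤m
  search-least {u} {v} k (suc fuel) r k≤m with reach G k u v in eq
  ... | true  = k≤m
  ... | false = search-least (suc k) fuel r (≤∧≢⇒< k≤m λ { refl → subst T eq r })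

  dist-least : ∀ {k u v} → Walk k u v → dist G u v ≤ k
  dist-least p = search-least 0 (suc n) (walk⇒reach p) z≤n

  adj⇒≢ : ∀ {u v} → adj u v ≡ true → u ≢ v
  adj⇒≢ {u} e refl with () ← trans (sym e) (irrefl u)

  nW : Fin n → Fin n → ℕ
  nW p q = count (λ w → does (dist G p w <? dist G q w))

  length-W : ∀ p q → length (W G p q) ≡ nW p q
  length-W p q = length-filter-tabulate (λ w → dist G p w <? dist G q w) (λ w → w)

  degree nEven weight : Fin n → ℕ
  degree p = count (λ w → dist G p w ≡ᵇ 1)
  nEven  p = count (λ w → not (odd (dist G p w)))
  weight p = nEven p + 2 * degree p

  nCommon : Fin n → Fin n → ℕ
  nCommon p q = count (λ w → (dist G p w ≡ᵇ 1) ∧ (dist G q w ≡ᵇ 1))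

  nCommon-comm : ∀ p q → nCommon p q ≡ nCommon q p
  nCommon-comm p q = sum-cong-≗ (λ w → cong χ (∧-comm (dist G p w ≡ᵇ 1) _))

  BalancedAt : ℕ → Set
  BalancedAt ℓ = ∀ u v → dist G u v ≡ ℓ → nW u v ≡ nW v u

  balancedAt? : ∀ ℓ → Dec (BalancedAt ℓ)
  balancedAt? ℓ = all? λ u → all? λ v → (dist G u v ℕ.≟ ℓ) →-dec (nW u v ℕ.≟ nW v u)

  module _ {D} (diameter : HasDiameter G D) where

    distBalanced⇔balancedAt : ∀ {ℓ} → ℓ ≤ D → DistBalanced G ℓ ⇔ BalancedAt ℓ
    distBalanced⇔balancedAt ℓ≤D = mk⇔
      (λ (_ , bal) u v d → trans (sym (length-W u v)) (trans (bal u v d) (length-W v u)))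
      (λ bal → far-pair , λ u v d → trans (length-W u v) (trans (bal u v d) (sym (length-W v u))))
      where
      far-pair : ∃[ u ] ∃[ v ] _ ≤ dist G u v
      far-pair = let (u₀ , v₀ , d₀) , _ = diameter in u₀ , v₀ , subst (_ ≤_) (sym d₀) ℓ≤D

    distBalanced? : ∀ {ℓ} → ℓ ≤ D → Dec (DistBalanced G ℓ)
    distBalanced? {ℓ} ℓ≤D =
      map′ (from (distBalanced⇔balancedAt ℓ≤D)) (to (distBalanced⇔balancedAt ℓ≤D)) (balancedAt? ℓ)

    highlyDistBalanced⇔ : HighlyDistBalanced G ⇔ (∀ ℓ → 1 ≤ ℓ → ℓ ≤ D → DistBalanced G ℓ)
    highlyDistBalanced⇔ = mk⇔
      (λ (D′ , (_ , bound′) , bal) ℓ 1≤ℓ ℓ≤D → bal ℓ 1≤ℓ (≤-trans ℓ≤D (D≤ bound′)))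
      (λ bal → D , diameter , bal)
      where
      D≤ : ∀ {D′} → (∀ u v → dist G u v ≤ D′) → D ≤ D′
      D≤ bound′ = let (u₀ , v₀ , d₀) , _ = diameter in subst (_≤ _) d₀ (bound′ u₀ v₀)

  module Distances (connected : Connected G) where

    dist-walk : ∀ u v → Walk (dist G u v) u v
    dist-walk u v
      with reach⇒walk (dist G u v) (search-reaches 0 (suc n) (from T-∨ (inj₁ (from T-≡ (connected u v)))))
    ... | j , j≤d , p = subst (λ k → Walk k u v) (≤-antisym j≤d (dist-least p)) p

    dist-refl : ∀ u → dist G u u ≡ 0
    dist-refl u = n≤0⇒n≡0 (dist-least {u = u} [])

    dist≡0⇒≡ : ∀ {u v} → dist G u v ≡ 0 → u ≡ v
    dist≡0⇒≡ {u} {v} d≡0 = walk₀ (subst (λ k → Walk k u v) d≡0 (dist-walk u v))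
      where
      walk₀ : Walk 0 u v → u ≡ v
      walk₀ [] = refl

    dist≡1⇒adj : ∀ {u v} → dist G u v ≡ 1 → adj u v ≡ true
    dist≡1⇒adj {u} {v} d≡1 = walk₁ (subst (λ k → Walk k u v) d≡1 (dist-walk u v))
      where
      walk₁ : Walk 1 u v → adj u v ≡ true
      walk₁ ([] ▷ e) = e

    adj⇒dist≡1 : ∀ {u v} → adj u v ≡ true → dist G u v ≡ 1
    adj⇒dist≡1 {u} {v} e with dist G u v in d | dist-least ([] ▷ e)
    ... | 0 | _ = contradiction (dist≡0⇒≡ d) (adj⇒≢ e)
    ... | 1 | _ = refl
    ... | suc (suc _) | s≤s ()

    adj-false⇒dist≢1 : ∀ {u v} → adj u v ≡ false → dist G u v ≢ 1
    adj-false⇒dist≢1 e d≡1 with () ← trans (sym (dist≡1⇒adj d≡1)) e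

    count-dist≡0 : ∀ p → count (λ w → dist G p w ≡ᵇ 0) ≡ 1
    count-dist≡0 p = count-unique _ p (≡⇒≡ᵇ _ 0 (dist-refl p)) (λ w t → sym (dist≡0⇒≡ (≡ᵇ⇒≡ _ 0 t)))

    module Colouring (colour : Fin n → Bool) (proper : ∀ u v → adj u v ≡ true → colour u ≢ colour v) where

      walk-parity : ∀ {k u v} → Walk k u v → odd k ≡ colour u xor colour v
      walk-parity {u = u} [] = sym (xor-same (colour u))
      walk-parity {suc k} {u} {v} (_▷_ {w = w} p e) = begin
        not (odd k)                  ≡⟨ cong not (walk-parity p) ⟩
        not (colour u xor colour w)  ≡⟨ not-distribʳ-xor (colour u) (colour w) ⟩
        colour u xor not (colour w)  ≡⟨ cong (colour u xor_) (¬-not (≢-sym (proper w v e))) ⟨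
        colour u xor colour v        ∎
        where open ≡-Reasoning

      dist-parity : ∀ u v → odd (dist G u v) ≡ colour u xor colour v
      dist-parity u v = walk-parity (dist-walk u v)

      same-colour⇒even-dist : ∀ {p q} → colour p ≡ colour q → odd (dist G p q) ≡ false
      same-colour⇒even-dist {p} {q} c≡ =
        trans (dist-parity p q) (trans (cong (_xor colour q) c≡) (xor-same (colour q)))

      opposite-colour⇒odd-dist : ∀ {p q} → colour p ≢ colour q → odd (dist G p q) ≡ true
      opposite-colour⇒odd-dist {p} {q} c≢ = begin
        odd (dist G p q)             ≡⟨ dist-parity p q ⟩
        colour p xor colour q        ≡⟨ cong (colour p xor_) (¬-not (≢-sym c≢)) ⟩
        colour p xor not (colour p)  ≡⟨ not-distribʳ-xor (colour p) (colour p) ⟨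
        not (colour p xor colour p)  ≡⟨ cong not (xor-same (colour p)) ⟩
        true                         ∎
        where open ≡-Reasoning

      odd-dist⇒opposite-colour : ∀ {p q} → odd (dist G p q) ≡ true → colour p ≢ colour q
      odd-dist⇒opposite-colour odd c≡ with () ← trans (sym odd) (same-colour⇒even-dist c≡)

      even-dist⇒same-colour : ∀ {p q} → odd (dist G p q) ≡ false → colour p ≡ colour q
      even-dist⇒same-colour {p} {q} even with colour p Bool.≟ colour q
      ... | yes c≡ = c≡
      ... | no c≢ with () ← trans (sym even) (opposite-colour⇒odd-dist c≢)

      odd-dist-flip : ∀ {p q} → colour p ≢ colour q → ∀ w → odd (dist G q w) ≡ not (odd (dist G p w))
      odd-dist-flip {p} {q} c≢ w = begin
        odd (dist G q w)             ≡⟨ dist-parity q w ⟩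
        colour q xor colour w        ≡⟨ cong (_xor colour w) (¬-not (≢-sym c≢)) ⟩
        not (colour p) xor colour w  ≡⟨ not-distribˡ-xor (colour p) (colour w) ⟨
        not (colour p xor colour w)  ≡⟨ cong not (dist-parity p w) ⟨
        not (odd (dist G p w))       ∎
        where open ≡-Reasoning

      odd-dist-same : ∀ {p q} → colour p ≡ colour q → ∀ w → odd (dist G q w) ≡ odd (dist G p w)
      odd-dist-same {p} {q} c≡ w =
        trans (dist-parity q w) (trans (cong (_xor colour w) (sym c≡)) (sym (dist-parity p w)))

      nEven-same : ∀ {p q} → colour p ≡ colour q → nEven p ≡ nEven q
      nEven-same c≡ = sum-cong-≗ (λ w → cong (χ ∘ not) (sym (odd-dist-same c≡ w)))

      module DiameterAtMost3 (dist≤3 : ∀ u v → dist G u v ≤ 3) where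

        same-colour-distinct⇒dist≡2 : ∀ {p q} → colour p ≡ colour q → p ≢ q → dist G p q ≡ 2
        same-colour-distinct⇒dist≡2 {p} {q} c≡ p≢q
          with dist G p q in d | dist≤3 p q | same-colour⇒even-dist c≡
        ... | 0 | _ | _ = contradiction (dist≡0⇒≡ d) p≢q
        ... | 2 | _ | _ = refl
        ... | suc (suc (suc (suc _))) | s≤s (s≤s (s≤s ())) | _

        nW-opposite-nonadjacent : ∀ {p q} → colour p ≢ colour q → adj p q ≡ false →
                                  nW p q + degree q ≡ nEven p + degree p
        nW-opposite-nonadjacent {p} {q} c≢ p≁q = sum-+-≗ _ _ _ _ λ w →
          opposite-nonadjacent-pointwise (dist G p w) (dist G q w) (dist≤3 p w) (dist≤3 q w) (odd-dist-flip c≢ w)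
            (λ p≡w → subst (λ x → dist G q x ≢ 1) (dist≡0⇒≡ p≡w) (adj-false⇒dist≢1 (trans (adj-sym q p) p≁q)))
            (λ q≡w → subst (λ x → dist G p x ≢ 1) (dist≡0⇒≡ q≡w) (adj-false⇒dist≢1 p≁q))

        -- The vertices p and q themselves break the pointwise identity of the non-adjacent case;
        -- counting the closed neighbourhoods instead repairs it.
        nW-adjacent : ∀ {p q} → adj p q ≡ true → nW p q + degree q ≡ nEven p + degree p
        nW-adjacent {p} {q} p~q = +-cancelʳ-≡ 1 _ _ (begin
          nW p q + degree q + 1     ≡⟨ +-assoc (nW p q) (degree q) 1 ⟩
          nW p q + (degree q + 1)   ≡⟨ cong (nW p q +_) (closedDegree≡ q) ⟨
          nW p q + closedDegree q   ≡⟨ sum-+-≗ _ _ _ _ pointwise ⟩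
          nEven p + closedDegree p  ≡⟨ cong (nEven p +_) (closedDegree≡ p) ⟩
          nEven p + (degree p + 1)  ≡⟨ +-assoc (nEven p) (degree p) 1 ⟨
          nEven p + degree p + 1    ∎)
          where
          open ≡-Reasoning
          closedDegree : Fin n → ℕ
          closedDegree x = sum (λ w → χ (dist G x w ≡ᵇ 1) + χ (dist G x w ≡ᵇ 0))
          closedDegree≡ : ∀ x → closedDegree x ≡ degree x + 1
          closedDegree≡ x = trans (∑-distrib-+ (λ w → χ (dist G x w ≡ᵇ 1)) (λ w → χ (dist G x w ≡ᵇ 0)))
                                  (cong (degree x +_) (count-dist≡0 x))
          pointwise : ∀ w → χ (does (dist G p w <? dist G q w)) + (χ (dist G q w ≡ᵇ 1) + χ (dist G q w ≡ᵇ 0))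
                          ≡ χ (not (odd (dist G p w))) + (χ (dist G p w ≡ᵇ 1) + χ (dist G p w ≡ᵇ 0))
          pointwise w = adjacent-pointwise (dist G p w) (dist G q w) (dist≤3 p w) (dist≤3 q w)
            (odd-dist-flip (proper p q p~q) w)
            (λ p≡w → subst (λ x → dist G q x ≡ 1) (dist≡0⇒≡ p≡w) (adj⇒dist≡1 (trans (adj-sym q p) p~q)))
            (λ q≡w → subst (λ x → dist G p x ≡ 1) (dist≡0⇒≡ q≡w) (adj⇒dist≡1 p~q))

        nW-opposite : ∀ {p q} → colour p ≢ colour q → nW p q + degree q ≡ nEven p + degree p
        nW-opposite {p} {q} c≢ with adj p q in e
        ... | true  = nW-adjacent e
        ... | false = nW-opposite-nonadjacent c≢ e

        nW-same : ∀ {p q} → colour p ≡ colour q → p ≢ q → nW p q + nCommon p q ≡ 1 + degree p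
        nW-same {p} {q} c≡ p≢q = trans (sum-+-≗ _ _ _ _ λ w →
          same-side-pointwise (dist G p w) (dist G q w) (dist≤3 p w) (dist≤3 q w) (odd-dist-same c≡ w)
            (λ p≡w q≡w → p≢q (trans (dist≡0⇒≡ p≡w) (sym (dist≡0⇒≡ q≡w))))
            (λ q≡w p≡w → p≢q (trans (dist≡0⇒≡ p≡w) (sym (dist≡0⇒≡ q≡w)))))
          (cong (_+ degree p) (count-dist≡0 p))

        balanced⇔weight-opposite : ∀ {p q} → colour p ≢ colour q → (nW p q ≡ nW q p ⇔ weight p ≡ weight q)
        balanced⇔weight-opposite c≢ = cross-offset-≡⇔ (nW-opposite c≢) (nW-opposite (≢-sym c≢))

        balanced⇔degree-same : ∀ {p q} → colour p ≡ colour q → p ≢ q → (nW p q ≡ nW q p ⇔ degree p ≡ degree q)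
        balanced⇔degree-same {p} {q} c≡ p≢q =
          offset-≡⇔ (nW-same c≡ p≢q) (trans (cong (nW q p +_) (nCommon-comm p q)) (nW-same (sym c≡) (≢-sym p≢q)))

        weight-along-walk : BalancedAt 1 → ∀ {k p q} → Walk k p q → weight p ≡ weight q
        weight-along-walk bal₁ []                  = refl
        weight-along-walk bal₁ (_▷_ {w = w} {v} p e) =
          trans (weight-along-walk bal₁ p) (to (balanced⇔weight-opposite (proper w v e)) (bal₁ w v (adj⇒dist≡1 e)))

        balanced₁⇒balanced₂ : BalancedAt 1 → BalancedAt 2
        balanced₁⇒balanced₂ bal₁ p q d≡2 =
          from (balanced⇔degree-same c≡ p≢q) (*-cancelˡ-≡ _ _ 2 (+-cancelˡ-≡ (nEven p) _ _ (begin
            nEven p + 2 * degree p  ≡⟨ weight-along-walk bal₁ (dist-walk p q) ⟩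
            nEven q + 2 * degree q  ≡⟨ cong (_+ 2 * degree q) (nEven-same c≡) ⟨
            nEven p + 2 * degree q  ∎)))
          where
          open ≡-Reasoning
          c≡ : colour p ≡ colour q
          c≡ = even-dist⇒same-colour (cong odd d≡2)
          p≢q : p ≢ q
          p≢q refl with () ← trans (sym d≡2) (dist-refl p)

        balanced₁⇒balanced₃ : BalancedAt 1 → BalancedAt 3
        balanced₁⇒balanced₃ bal₁ p q d≡3 =
          from (balanced⇔weight-opposite (odd-dist⇒opposite-colour {p} {q} (cong odd d≡3)))
               (weight-along-walk bal₁ (dist-walk p q))

        weight-same-colour : BalancedAt 2 → ∀ {p q} → colour p ≡ colour q → weight p ≡ weight q
        weight-same-colour bal₂ {p} {q} c≡ with p ≟ q
        ... | yes refl = refl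
        ... | no p≢q   = cong₂ _+_ (nEven-same c≡)
          (cong (2 *_) (to (balanced⇔degree-same c≡ p≢q) (bal₂ p q (same-colour-distinct⇒dist≡2 c≡ p≢q))))

        balanced₂₃⇒balanced₁ : ∀ {u₀ v₀} → dist G u₀ v₀ ≡ 3 → BalancedAt 2 → BalancedAt 3 → BalancedAt 1
        balanced₂₃⇒balanced₁ {u₀} {v₀} d₀ bal₂ bal₃ a b d≡1 =
          from (balanced⇔weight-opposite (proper a b (dist≡1⇒adj d≡1)))
               (trans (weight≡weight-u₀ a) (sym (weight≡weight-u₀ b)))
          where
          c₀ : colour u₀ ≢ colour v₀
          c₀ = odd-dist⇒opposite-colour (cong odd d₀)
          weight≡weight-u₀ : ∀ x → weight x ≡ weight u₀
          weight≡weight-u₀ x with colour x Bool.≟ colour u₀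
          ... | yes c≡ = weight-same-colour bal₂ {x} {u₀} c≡
          ... | no c≢  = trans (weight-same-colour bal₂ {x} {v₀} (trans (¬-not c≢) (sym (¬-not (≢-sym c₀)))))
                               (sym (to (balanced⇔weight-opposite c₀) (bal₃ u₀ v₀ d₀)))

        balanced₁⇒balanced-up-to-3 : BalancedAt 1 → ∀ ℓ → 1 ≤ ℓ → ℓ ≤ 3 → BalancedAt ℓ
        balanced₁⇒balanced-up-to-3 bal₁ 1 _ _ = bal₁
        balanced₁⇒balanced-up-to-3 bal₁ 2 _ _ = balanced₁⇒balanced₂ bal₁
        balanced₁⇒balanced-up-to-3 bal₁ 3 _ _ = balanced₁⇒balanced₃ bal₁
        balanced₁⇒balanced-up-to-3 _ (suc (suc (suc (suc _)))) _ (s≤s (s≤s (s≤s ())))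

exactlyOne4-of-three : {P A B C : Set} → P ⇔ A → Dec A → Dec B → Dec C → (B → C → A) →
                       ExactlyOne4 P (B × ¬ A × ¬ C) (C × ¬ A × ¬ B) (¬ A × ¬ B × ¬ C)
exactlyOne4-of-three {P} {A} {B} {C} P⇔A A? B? C? B⇒C⇒A =
  cases A? B? C? ,
  (λ (p , _ , ¬a , _) → ¬a (to P⇔A p)) , (λ (p , _ , ¬a , _) → ¬a (to P⇔A p)) , (λ (p , ¬a , _) → ¬a (to P⇔A p)) ,
  (λ ((b , _) , _ , _ , ¬b) → ¬b b) , (λ ((b , _) , _ , ¬b , _) → ¬b b) , (λ ((c , _) , _ , _ , ¬c) → ¬c c)
  where
  cases : Dec A → Dec B → Dec C → P ⊎ (B × ¬ A × ¬ C) ⊎ (C × ¬ A × ¬ B) ⊎ (¬ A × ¬ B × ¬ C)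
  cases (yes a) _       _       = inj₁ (from P⇔A a)
  cases (no ¬a) (yes b) (yes c) = contradiction (B⇒C⇒A b c) ¬a
  cases (no ¬a) (yes b) (no ¬c) = inj₂ (inj₁ (b , ¬a , ¬c))
  cases (no ¬a) (no ¬b) (yes c) = inj₂ (inj₂ (inj₁ (c , ¬a , ¬b)))
  cases (no ¬a) (no ¬b) (no ¬c) = inj₂ (inj₂ (inj₂ (¬a , ¬b , ¬c)))

theorem3p8 : (G : Graph) → Connected G → Bipartite G → HasDiameter G 3 →
    ExactlyOne4
      (HighlyDistBalanced G)
      (DistBalanced G 2 × ¬ DistBalanced G 1 × ¬ DistBalanced G 3)
      (DistBalanced G 3 × ¬ DistBalanced G 1 × ¬ DistBalanced G 2)
      (¬ DistBalanced G 1 × ¬ DistBalanced G 2 × ¬ DistBalanced G 3)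
theorem3p8 G connected (colour , proper) diameter@((_ , _ , d₀) , dist≤3) =
  exactlyOne4-of-three highly⇔balanced₁
    (distBalanced? G diameter 1≤3) (distBalanced? G diameter 2≤3) (distBalanced? G diameter ≤-refl)
    λ db₂ db₃ → from (db⇔ 1≤3) (balanced₂₃⇒balanced₁ d₀ (to (db⇔ 2≤3) db₂) (to (db⇔ ≤-refl) db₃))
  where
  open Distances G connected
  open Colouring colour proper
  open DiameterAtMost3 dist≤3
  1≤3 : 1 ≤ 3
  1≤3 = s≤s z≤n
  2≤3 : 2 ≤ 3
  2≤3 = s≤s (s≤s z≤n)
  db⇔ : ∀ {ℓ} → ℓ ≤ 3 → DistBalanced G ℓ ⇔ BalancedAt G ℓ
  db⇔ = distBalanced⇔balancedAt G diameter
  highly⇔balanced₁ : HighlyDistBalanced G ⇔ DistBalanced G 1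
  highly⇔balanced₁ = mk⇔
    (λ highly → to (highlyDistBalanced⇔ G diameter) highly 1 ≤-refl 1≤3)
    (λ db₁ → from (highlyDistBalanced⇔ G diameter) λ ℓ 1≤ℓ ℓ≤3 →
      from (db⇔ ℓ≤3) (balanced₁⇒balanced-up-to-3 (to (db⇔ 1≤3) db₁) ℓ 1≤ℓ ℓ≤3))
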